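{- Let $\mathbf{ILX}$ be any logic extending $\mathbf{IL}$, $\Gamma,\Delta$ $\mathbf{ILX}$-MCSs and $S$ a set of formulas. (1) If $\Gamma\prec_S\Delta$ and $S\vdash_{\mathbf{ILX}}\varphi$, then $\Gamma\prec_{S\cup\{\varphi\}}\Delta$. (2) If $\Gamma\prec_S\Delta$, then $\Gamma\prec_{S\cup\Box S}\Delta$, where $\Box S=\{\Box A:A\in S\}$.
   Context: Formulas: $\bot$, propositional variables, $\to$, $\Box$, binary $\rhd$; $\Diamond A:=\neg\Box\neg A$. $\mathbf{IL}$: classical tautologies, K, L: $\Box(\Box A\to A)\to\Box A$, J1: $\Box(A\to B)\to A\rhd B$, J2: $(A\rhd B)\wedge(B\rhd C)\to A\rhd C$, J3: $(A\rhd C)\wedge(B\rhd C)\to A\vee B\rhd C$, J4: $A\rhd B\to(\Diamond A\to\Diamond B)$, J5: $\Diamond A\rhd A$; rules modus ponens and necessitation. $S\vdash_{\mathbf{ILX}}\varphi$ means there is a finite sequence ending in $\varphi$ each element of which is a theorem of $\mathbf{ILX}$, a member of $S$, or obtained by modus ponens from earlier elements. An $\mathbf{ILX}$-MCS is a maximal $\mathbf{ILX}$-consistent set. $\Gamma\prec_S\Delta$ iff for every formula $A$ and finite $S'\subseteq S$, $\neg A\rhd\bigvee_{\sigma\in S'}\neg\sigma\in\Gamma$ implies $A,\Box A\in\Delta$ (empty disjunction is $\bot$). -}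

module Defs where

open import Data.Nat using (ℕ)
open import Data.Bool using (Bool; true; false; not; _∨_)
open import Data.List using (List; []; _∷_)
open import Data.List.Relation.Unary.All using (All)
open import Data.Product using (_×_)
open import Data.Sum using (_⊎_)
open import Relation.Binary.PropositionalEquality using (_≡_)
open import Relation.Nullary using (¬_)

infixr 5 _⇒_
infix 6 _▷_

data Formula : Set where
  ⊥′  : Formula
  var : ℕ → Formula
  _⇒_ : Formula → Formula → Formula
  □   : Formula → Formula
  _▷_ : Formula → Formula → Formula

~_ : Formula → Formula
~ A = A ⇒ ⊥′

_∨′_ : Formula → Formula → Formula
A ∨′ B = (~ A) ⇒ B

_∧′_ : Formula → Formula → Formula
A ∧′ B = ~ (A ⇒ ~ B)

◇ : Formula → Formula
◇ A = ~ (□ (~ A))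

-- Classical tautologies: boxed formulas and ▷-formulas are treated as atoms
eval : (Formula → Bool) → Formula → Bool
eval v ⊥′ = false
eval v (var p) = v (var p)
eval v (A ⇒ B) = not (eval v A) ∨ eval v B
eval v (□ A) = v (□ A)
eval v (A ▷ B) = v (A ▷ B)

Tautology : Formula → Set
Tautology A = ∀ (v : Formula → Bool) → eval v A ≡ true

data ILAxiom : Formula → Set where
  taut : ∀ {A} → Tautology A → ILAxiom A
  axK  : ∀ A B → ILAxiom (□ (A ⇒ B) ⇒ □ A ⇒ □ B)
  axL  : ∀ A → ILAxiom (□ (□ A ⇒ A) ⇒ □ A)
  axJ1 : ∀ A B → ILAxiom (□ (A ⇒ B) ⇒ (A ▷ B))
  axJ2 : ∀ A B C → ILAxiom (((A ▷ B) ∧′ (B ▷ C)) ⇒ (A ▷ C))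
  axJ3 : ∀ A B C → ILAxiom (((A ▷ C) ∧′ (B ▷ C)) ⇒ ((A ∨′ B) ▷ C))
  axJ4 : ∀ A B → ILAxiom ((A ▷ B) ⇒ (◇ A ⇒ ◇ B))
  axJ5 : ∀ A → ILAxiom (◇ A ▷ A)

record ExtendsIL (L : Formula → Set) : Set where
  field
    ax  : ∀ {A} → ILAxiom A → L A
    mp  : ∀ {A B} → L (A ⇒ B) → L A → L B
    nec : ∀ {A} → L A → L (□ A)

FSet : Set₁
FSet = Formula → Set

_⊆_ : FSet → FSet → Set
X ⊆ Y = ∀ {A} → X A → Y A

_∪｛_｝ : FSet → Formula → FSet
(S ∪｛ φ ｝) A = S A ⊎ (A ≡ φ)

data WithBoxes (S : FSet) : FSet where
  old   : ∀ {A} → S A → WithBoxes S A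
  boxed : ∀ {A} → S A → WithBoxes S (□ A)

data Der (L : FSet) (S : FSet) : Formula → Set where
  thm  : ∀ {A} → L A → Der L S A
  hyp  : ∀ {A} → S A → Der L S A
  mpD  : ∀ {A B} → Der L S (A ⇒ B) → Der L S A → Der L S B

Consistent : FSet → FSet → Set
Consistent L S = ¬ Der L S ⊥′

MCS : FSet → FSet → Set₁
MCS L Γ = Consistent L Γ × (∀ (Δ : FSet) → Γ ⊆ Δ → Consistent L Δ → Δ ⊆ Γ)

⋁ : List Formula → Formula
⋁ [] = ⊥′
⋁ (A ∷ []) = A
⋁ (A ∷ B ∷ As) = A ∨′ ⋁ (B ∷ As)

negs : List Formula → List Formula
negs [] = []
negs (σ ∷ σs) = (~ σ) ∷ negs σs

Prec : FSet → FSet → FSet → Set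
Prec Γ S Δ = ∀ (A : Formula) (S′ : List Formula) → All S S′ →
  Γ ((~ A) ▷ ⋁ (negs S′)) → Δ A × Δ (□ A)

-- Call a formula P "S-bounded" if ⊢ P ▷ ⋁{¬σ : σ ∈ T} for some finite T ⊆ S.
-- The whole lemma rests on one transfer principle: if ¬x is S-bounded for
-- every x ∈ X, then Γ ≺_S Δ implies Γ ≺_X Δ.  Indeed, given
-- ¬A ▷ ⋁¬S′ ∈ Γ with S′ ⊆ X finite, the disjunction ⋁¬S′ is S-bounded (J3
-- joins the bounds of its disjuncts), so by J2 and deductive closure of the
-- MCS Γ we get ¬A ▷ ⋁¬T ∈ Γ with T ⊆ S, and Γ ≺_S Δ yields A, □A ∈ Δ.
-- It therefore suffices to bound the negations of the new elements:
--   (1) if S ⊢ φ then ¬φ is S-bounded, by induction on the derivation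
--       (modus ponens: ¬B implies ¬(A → B) ∨ ¬A, and J3 joins the bounds);
--   (2) ¬□σ is S-bounded for σ ∈ S, since ¬□σ ↔ ◇¬σ and ◇¬σ ▷ ¬σ by J5.
module Submission where

open import Defs
open import Data.Bool using (true; false; not; _∨_)
open import Data.Bool.Properties using (∨-zeroʳ)
open import Data.Product using (_×_; _,_; Σ; ∃)
open import Data.Sum using (_⊎_; inj₁; inj₂; [_,_]′)
open import Data.List using (List; []; _∷_; _++_)
open import Data.List.Membership.Propositional using (_∈_)
open import Data.List.Relation.Binary.Subset.Propositional using () renaming (_⊆_ to _⊆ˡ_)
open import Data.List.Relation.Binary.Subset.Propositional.Properties using (xs⊆xs++ys; xs⊆ys++xs)
open import Data.List.Relation.Unary.All using (All; []; _∷_)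
open import Data.List.Relation.Unary.All.Properties using (++⁺)
open import Data.List.Relation.Unary.Any using (here; there)
open import Relation.Binary.PropositionalEquality using (_≡_; refl)

tautology-⇒ : ∀ {P Q} → (∀ v → eval v P ≡ true → eval v Q ≡ true) → Tautology (P ⇒ Q)
tautology-⇒ {P} h v with eval v P in eq
... | true  = h v eq
... | false = refl

-- eval v (A ∨′ B) unfolds to  not (not a ∨ false) ∨ b  with a, b the values
-- of A and B; it is true exactly when one of a, b is.
∨′-true⁻ : ∀ a b → not (not a ∨ false) ∨ b ≡ true → a ≡ true ⊎ b ≡ true
∨′-true⁻ true  b e = inj₁ refl
∨′-true⁻ false b e = inj₂ e

∨′-trueˡ : ∀ {a} b → a ≡ true → not (not a ∨ false) ∨ b ≡ true
∨′-trueˡ b refl = refl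

⋁-true⁻ : ∀ v xs → eval v (⋁ xs) ≡ true → ∃ λ x → x ∈ xs × eval v x ≡ true
⋁-true⁻ v (A ∷ []) e = A , here refl , e
⋁-true⁻ v (A ∷ B ∷ As) e =
  [ (λ eA → A , here refl , eA)
  , (λ eR → let (x , x∈ , ex) = ⋁-true⁻ v (B ∷ As) eR in x , there x∈ , ex)
  ]′ (∨′-true⁻ (eval v A) _ e)

⋁-true⁺ : ∀ v {x} xs → x ∈ xs → eval v x ≡ true → eval v (⋁ xs) ≡ true
⋁-true⁺ v (A ∷ []) (here refl) e = e
⋁-true⁺ v (A ∷ B ∷ As) (here refl) e = ∨′-trueˡ _ e
⋁-true⁺ v (A ∷ B ∷ As) (there x∈) e rewrite ⋁-true⁺ v (B ∷ As) x∈ e = ∨-zeroʳ _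

⋁-mono : ∀ {xs ys} → xs ⊆ˡ ys → Tautology (⋁ xs ⇒ ⋁ ys)
⋁-mono {xs} {ys} xs⊆ys = tautology-⇒ {⋁ xs} {⋁ ys} λ v e →
  let (x , x∈ , ex) = ⋁-true⁻ v xs e in ⋁-true⁺ v ys (xs⊆ys x∈) ex

∈-negs : ∀ {σ T} → σ ∈ T → (~ σ) ∈ negs T
∈-negs (here refl) = here refl
∈-negs (there σ∈) = there (∈-negs σ∈)

negs-mono : ∀ {T T′} → T ⊆ˡ T′ → negs T ⊆ˡ negs T′
negs-mono {σ ∷ T} T⊆T′ (here refl) = ∈-negs (T⊆T′ (here refl))
negs-mono {σ ∷ T} T⊆T′ (there x∈) = negs-mono (λ σ∈ → T⊆T′ (there σ∈)) x∈

identity-taut : ∀ P → Tautology (P ⇒ P)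
identity-taut P = tautology-⇒ {P} {P} λ _ e → e

conj-taut : ∀ P Q → Tautology (P ⇒ Q ⇒ (P ∧′ Q))
conj-taut P Q v with eval v P | eval v Q
... | true  | true  = refl
... | true  | false = refl
... | false | _     = refl

refute-taut : ∀ P → Tautology (P ⇒ (~ P ⇒ ⊥′))
refute-taut P v with eval v P
... | true  = refl
... | false = refl

-- ¬B ⊢ ¬(A → B) ∨ ¬A: the propositional core of the modus ponens case.
mp-taut : ∀ A B → Tautology (~ B ⇒ ((~ (A ⇒ B)) ∨′ (~ A)))
mp-taut A B v with eval v A | eval v B
... | true  | true  = refl
... | true  | false = refl
... | false | true  = refl
... | false | false = refl

double-negation-taut : ∀ P → Tautology (~ (~ P) ⇒ P)
double-negation-taut P v with eval v P
... | true  = refl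
... | false = refl

contraposition-taut : ∀ P Q → Tautology ((P ⇒ Q) ⇒ (~ Q ⇒ ~ P))
contraposition-taut P Q v with eval v P | eval v Q
... | true  | true  = refl
... | true  | false = refl
... | false | true  = refl
... | false | false = refl

module InterpretabilityFacts (L : FSet) (E : ExtendsIL L) where
  open ExtendsIL E

  tautological : ∀ {A} → Tautology A → L A
  tautological t = ax (taut t)

  mp₂ : ∀ {A B C} → L (A ⇒ B ⇒ C) → L A → L B → L C
  mp₂ f a b = mp (mp f a) b

  ▷-intro : ∀ {A B} → L (A ⇒ B) → L (A ▷ B)
  ▷-intro {A} {B} p = mp (ax (axJ1 A B)) (nec p)

  ▷-trans : ∀ {A B C} → L (A ▷ B) → L (B ▷ C) → L (A ▷ C)
  ▷-trans {A} {B} {C} p q = mp (ax (axJ2 A B C)) (mp₂ (tautological (conj-taut (A ▷ B) (B ▷ C))) p q)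

  ▷-join : ∀ {A B C} → L (A ▷ C) → L (B ▷ C) → L ((A ∨′ B) ▷ C)
  ▷-join {A} {B} {C} p q = mp (ax (axJ3 A B C)) (mp₂ (tautological (conj-taut (A ▷ C) (B ▷ C))) p q)

  Bounded : FSet → Formula → Set
  Bounded S P = Σ (List Formula) λ T → All S T × L (P ▷ ⋁ (negs T))

  bounded-▷ : ∀ {S P Q} → L (P ▷ Q) → Bounded S Q → Bounded S P
  bounded-▷ P▷Q (T , T⊆S , Q▷T) = T , T⊆S , ▷-trans P▷Q Q▷T

  bounded-⊥ : ∀ {S} → Bounded S ⊥′
  bounded-⊥ = [] , [] , ▷-intro (tautological (identity-taut ⊥′))

  bounded-member : ∀ {S σ} → S σ → Bounded S (~ σ)
  bounded-member {σ = σ} σ∈S = σ ∷ [] , σ∈S ∷ [] , ▷-intro (tautological (identity-taut (~ σ)))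

  bounded-∨ : ∀ {S P Q} → Bounded S P → Bounded S Q → Bounded S (P ∨′ Q)
  bounded-∨ (T , T⊆S , P▷T) (R , R⊆S , Q▷R) =
    T ++ R , ++⁺ T⊆S R⊆S ,
    ▷-join (enlarge P▷T (xs⊆xs++ys T R)) (enlarge Q▷R (xs⊆ys++xs R T))
    where
    enlarge : ∀ {P T T′} → L (P ▷ ⋁ (negs T)) → T ⊆ˡ T′ → L (P ▷ ⋁ (negs T′))
    enlarge P▷T T⊆T′ = ▷-trans P▷T (▷-intro (tautological (⋁-mono (negs-mono T⊆T′))))

  bounded-⋁ : ∀ {S} Ps → All (Bounded S) Ps → Bounded S (⋁ Ps)
  bounded-⋁ [] [] = bounded-⊥
  bounded-⋁ (P ∷ []) (bP ∷ []) = bP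
  bounded-⋁ (P ∷ Q ∷ Ps) (bP ∷ bPs) = bounded-∨ bP (bounded-⋁ (Q ∷ Ps) bPs)

  Reduces : FSet → FSet → Set
  Reduces X S = ∀ {x} → X x → Bounded S (~ x)

  bounded-negs : ∀ {X S} → Reduces X S → ∀ {xs} → All X xs → All (Bounded S) (negs xs)
  bounded-negs red [] = []
  bounded-negs red (x∈X ∷ xs∈X) = red x∈X ∷ bounded-negs red xs∈X

  bounded-derivable : ∀ {S φ} → Der L S φ → Bounded S (~ φ)
  bounded-derivable {φ = φ} (thm ⊢φ) =
    bounded-▷ (▷-intro (mp (tautological (refute-taut φ)) ⊢φ)) bounded-⊥
  bounded-derivable (hyp φ∈S) = bounded-member φ∈S
  bounded-derivable (mpD {A} {B} dA⇒B dA) =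
    bounded-▷ (▷-intro (tautological (mp-taut A B)))
              (bounded-∨ (bounded-derivable dA⇒B) (bounded-derivable dA))

  -- Part (2): ¬□σ ⊢ ◇¬σ, and ◇¬σ ▷ ¬σ by J5.
  bounded-box : ∀ {S σ} → S σ → Bounded S (~ (□ σ))
  bounded-box {σ = σ} σ∈S = bounded-▷ (▷-trans (▷-intro ¬□σ⇒◇¬σ) (ax (axJ5 (~ σ)))) (bounded-member σ∈S)
    where
    □¬¬σ⇒□σ : L (□ (~ (~ σ)) ⇒ □ σ)
    □¬¬σ⇒□σ = mp (ax (axK (~ (~ σ)) σ)) (nec (tautological (double-negation-taut σ)))
    ¬□σ⇒◇¬σ : L (~ (□ σ) ⇒ ◇ (~ σ))
    ¬□σ⇒◇¬σ = mp (tautological (contraposition-taut (□ (~ (~ σ))) (□ σ))) □¬¬σ⇒□σ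

  reduces-∪ : ∀ {S φ} → Der L S φ → Reduces (S ∪｛ φ ｝) S
  reduces-∪ d (inj₁ x∈S) = bounded-member x∈S
  reduces-∪ d (inj₂ refl) = bounded-derivable d

  reduces-boxes : ∀ {S} → Reduces (WithBoxes S) S
  reduces-boxes (old x∈S) = bounded-member x∈S
  reduces-boxes (boxed σ∈S) = bounded-box σ∈S

  mcs-closed : ∀ {Γ A} → MCS L Γ → Der L Γ A → Γ A
  mcs-closed {Γ} (consistent , maximal) = maximal (Der L Γ) hyp (λ d → consistent (flatten d))
    where
    flatten : ∀ {A} → Der L (Der L Γ) A → Der L Γ A
    flatten (thm ⊢A) = thm ⊢A
    flatten (hyp d) = d
    flatten (mpD d₁ d₂) = mpD (flatten d₁) (flatten d₂)

  mcs-▷-trans : ∀ {Γ A B C} → MCS L Γ → Γ (A ▷ B) → L (B ▷ C) → Γ (A ▷ C)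
  mcs-▷-trans {A = A} {B} {C} M A▷B∈Γ ⊢B▷C = mcs-closed M
    (mpD (thm (ax (axJ2 A B C)))
         (mpD (mpD (thm (tautological (conj-taut (A ▷ B) (B ▷ C)))) (hyp A▷B∈Γ)) (thm ⊢B▷C)))

  prec-reduce : ∀ {Γ Δ X S} → MCS L Γ → Reduces X S → Prec Γ S Δ → Prec Γ X Δ
  prec-reduce M red prec A S′ S′⊆X ¬A▷S′∈Γ =
    let (T , T⊆S , S′▷T) = bounded-⋁ (negs S′) (bounded-negs red S′⊆X)
    in prec A T T⊆S (mcs-▷-trans M ¬A▷S′∈Γ S′▷T)

lemma4p6 : (L : FSet) → ExtendsIL L → (Γ Δ S : FSet) → MCS L Γ → MCS L Δ →
    ((φ : Formula) → Prec Γ S Δ → Der L S φ → Prec Γ (S ∪｛ φ ｝) Δ)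
    × (Prec Γ S Δ → Prec Γ (WithBoxes S) Δ)
lemma4p6 L E Γ Δ S MΓ _ =
  (λ φ prec d → prec-reduce MΓ (reduces-∪ d) prec) ,
  (λ prec → prec-reduce MΓ reduces-boxes prec)
  where open InterpretabilityFacts L E
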